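{- Let $r > s \geq 1$ be integers and $\alpha \in (0,1)$. Then there exist constants $0 < \gamma_0 < \gamma_1 < 1$ and $n_2 > 0$ such that for all integers $n \geq n_2$, $t$ with $0 \le t \leq \gamma_0 n$, and $p$ with $\gamma_1 n \le p \le n$, \[ \alpha\, N(n,p,r,s) > N(n,t,r,s). \]
   Context: For integers $r \ge s \ge 1$ and $0 \le t \le n$, $N(n,t,r,s) = \binom{n-s+1}{r-s+1} - \binom{n-s+1-t}{r-s+1}$ (equivalently $\sum_{i=1}^{t} \binom{n-s+1-i}{r-s}$).
   Formalization: The parameter α ranges over the rationals in (0,1), and the constants γ₀ and γ₁ are taken in ℚ. -}

module Defs where

open import Data.Nat using (ℕ; _+_; _∸_)
open import Data.Nat.Combinatorics using (_C_)
open import Data.Integer using (+_)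
open import Data.Rational using (ℚ; _/_)

N : ℕ → ℕ → ℕ → ℕ → ℕ
N n t r s = ((n ∸ s + 1) C (r ∸ s + 1)) ∸ ((n ∸ s + 1 ∸ t) C (r ∸ s + 1))

ℕ→ℚ : ℕ → ℚ
ℕ→ℚ m = (+ m) / 1

module Submission where

-- Put M = n - s + 1 and K = r - s + 1.  Then N(n,t,r,s) = C(M,K) - C(M-t,K)
-- counts the K-subsets of an M-set that meet a fixed t-subset.  Two
-- elementary estimates control this count:
--   * the t Pascal steps from C(M-t,K) up to C(M,K) each add at most
--     C(M-1,K-1) = (K/M)·C(M,K), so  M·N(t) ≤ t·K·C(M,K);
--   * j ↦ C(j,K)/j is non-decreasing, so C(M-p,K) ≤ ((M-p)/M)·C(M,K),
--     whence  M·N(p) ≥ min(p,M)·C(M,K).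
-- Consequently D·N(t) < N(p) as soon as K·D·t < min(p,M).  Writing the
-- positive rational α as (a+1)/D, we choose γ₀ = 1/(4KD+1), γ₁ = 1/2 and
-- n₂ = 2r: the hypotheses then give 4KDt ≤ n ≤ 2·min(p,M), so
-- K·D·t < min(p,M), and D·N(t) < N(p) implies N(t) < α·N(p).

open import Defs

module Binomial where

  open import Data.Nat
  open import Data.Nat.Properties
  open import Data.Nat.Combinatorics using (_C_; nCk+nC[k+1]≡[n+1]C[k+1]; nCn≡1; nC1≡n)
  open import Data.Nat.Tactic.RingSolver using (solve-∀)
  open import Relation.Binary.PropositionalEquality
  open import Algebra.Properties.CommutativeSemigroup *-commutativeSemigroup using (x∙yz≈y∙xz)

  pascal : ∀ n k → suc n C suc k ≡ n C k + n C suc k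
  pascal n k = sym (nCk+nC[k+1]≡[n+1]C[k+1] n k)

  C-step : ∀ n k → n C k ≤ suc n C k
  C-step n zero = ≤-refl
  C-step n (suc k) rewrite pascal n k = m≤n+m (n C suc k) (n C k)

  C-monoˡ : ∀ {n m} k → n ≤ m → n C k ≤ m C k
  C-monoˡ k n≤m = along (≤⇒≤′ n≤m)
    where
    along : ∀ {n m} → n ≤′ m → n C k ≤ m C k
    along ≤′-refl = ≤-refl
    along (≤′-step n≤′m) = ≤-trans (along n≤′m) (C-step _ k)

  C-pos : ∀ {n k} → k ≤ n → 0 < n C k
  C-pos {n} {k} k≤n = ≤-trans (≤-reflexive (sym (nCn≡1 k))) (C-monoˡ k k≤n)

  absorption : ∀ n k → suc n * (n C k) ≡ suc k * (suc n C suc k)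
  absorption zero zero = refl
  absorption zero (suc k) = sym (*-zeroʳ (suc (suc k)))
  absorption (suc n) zero =
    trans (*-identityʳ (suc (suc n))) (sym (trans (+-identityʳ _) (nC1≡n (suc (suc n)))))
  absorption (suc n) (suc k) = begin
      suc (suc n) * (suc n C suc k)          ≡⟨ cong (suc (suc n) *_) (pascal n k) ⟩
      suc (suc n) * (a + b)                  ≡⟨ split n a b ⟩
      (suc n * a + a) + (suc n * b + b)      ≡⟨ cong₂ (λ x y → x + a + (y + b)) (absorption n k) (absorption n (suc k)) ⟩
      (suc k * (suc n C suc k) + a) + (suc (suc k) * d + b)
                                             ≡⟨ cong (λ c → suc k * c + a + (suc (suc k) * d + b)) (pascal n k) ⟩
      (suc k * (a + b) + a) + (suc (suc k) * d + b)
                                             ≡⟨ merge k a b d ⟩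
      suc (suc k) * ((a + b) + d)            ≡⟨ cong (λ c → suc (suc k) * (c + d)) (sym (pascal n k)) ⟩
      suc (suc k) * (suc n C suc k + d)      ≡⟨ cong (suc (suc k) *_) (sym (pascal (suc n) (suc k))) ⟩
      suc (suc k) * (suc (suc n) C suc (suc k)) ∎
    where
    open ≡-Reasoning
    a = n C k
    b = n C suc k
    d = suc n C suc (suc k)
    split : ∀ n a b → suc (suc n) * (a + b) ≡ (suc n * a + a) + (suc n * b + b)
    split = solve-∀
    merge : ∀ k a b d → (suc k * (a + b) + a) + (suc (suc k) * d + b) ≡ suc (suc k) * ((a + b) + d)
    merge = solve-∀

  -- Climbing d rows from C(j,k+1) adds one coefficient C(i,k) ≤ C(m,k) per row,
  -- as long as the rows stay below m+1.
  C-growth : ∀ m k d j → d + j ≤ suc m → (d + j) C suc k ≤ j C suc k + d * (m C k)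
  C-growth m k zero j _ = m≤m+n (j C suc k) 0
  C-growth m k (suc d) j d+j<1+m = begin
      suc (d + j) C suc k                     ≡⟨ pascal (d + j) k ⟩
      (d + j) C k + (d + j) C suc k           ≤⟨ +-mono-≤ (C-monoˡ k (s≤s⁻¹ d+j<1+m)) (C-growth m k d j (<⇒≤ d+j<1+m)) ⟩
      m C k + (j C suc k + d * (m C k))       ≡⟨ x+[y+z]≡y+[x+z] (m C k) (j C suc k) (d * (m C k)) ⟩
      j C suc k + (m C k + d * (m C k))       ∎
    where
    open ≤-Reasoning
    x+[y+z]≡y+[x+z] : ∀ x y z → x + (y + z) ≡ y + (x + z)
    x+[y+z]≡y+[x+z] = solve-∀

  C-drop : ∀ m k t → suc m C suc k ≤ (suc m ∸ t) C suc k + t * (m C k)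
  C-drop m k t = begin
      suc m C suc k                              ≡⟨ cong (_C suc k) (sym rows) ⟩
      (t ⊓ suc m + (suc m ∸ t)) C suc k          ≤⟨ C-growth m k (t ⊓ suc m) (suc m ∸ t) (≤-reflexive rows) ⟩
      (suc m ∸ t) C suc k + t ⊓ suc m * (m C k)  ≤⟨ +-monoʳ-≤ _ (*-monoˡ-≤ (m C k) (m⊓n≤m t (suc m))) ⟩
      (suc m ∸ t) C suc k + t * (m C k)          ∎
    where
    open ≤-Reasoning
    rows : t ⊓ suc m + (suc m ∸ t) ≡ suc m
    rows = m⊓n+n∸m≡n t (suc m)

  C-ratio : ∀ {j M} k → j ≤ M → M * (j C suc k) ≤ j * (M C suc k)
  C-ratio {M = M} k z≤n = ≤-reflexive (*-zeroʳ M)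
  C-ratio k (s≤s {j} {m} j≤m) = *-cancelˡ-≤ (suc k) (begin
      suc k * (suc m * (suc j C suc k))   ≡⟨ x∙yz≈y∙xz (suc k) (suc m) _ ⟩
      suc m * (suc k * (suc j C suc k))   ≡⟨ cong (suc m *_) (sym (absorption j k)) ⟩
      suc m * (suc j * (j C k))           ≤⟨ *-monoʳ-≤ (suc m) (*-monoʳ-≤ (suc j) (C-monoˡ k j≤m)) ⟩
      suc m * (suc j * (m C k))           ≡⟨ x∙yz≈y∙xz (suc m) (suc j) _ ⟩
      suc j * (suc m * (m C k))           ≡⟨ cong (suc j *_) (absorption m k) ⟩
      suc j * (suc k * (suc m C suc k))   ≡⟨ x∙yz≈y∙xz (suc j) (suc k) _ ⟩
      suc k * (suc j * (suc m C suc k))   ∎)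
    where open ≤-Reasoning

  ∸-∸≡⊓ : ∀ m n → m ∸ (m ∸ n) ≡ n ⊓ m
  ∸-∸≡⊓ m n = begin
      m ∸ (m ∸ n)                   ≡⟨ cong (_∸ (m ∸ n)) (sym (m⊓n+n∸m≡n n m)) ⟩
      (n ⊓ m + (m ∸ n)) ∸ (m ∸ n)   ≡⟨ m+n∸n≡m (n ⊓ m) (m ∸ n) ⟩
      n ⊓ m                         ∎
    where open ≡-Reasoning

  meeting : ℕ → ℕ → ℕ → ℕ
  meeting M K t = M C K ∸ (M ∸ t) C K

  meeting-upper : ∀ m k t → suc m * meeting (suc m) (suc k) t ≤ t * (suc k * (suc m C suc k))
  meeting-upper m k t = begin
      suc m * meeting (suc m) (suc k) t   ≤⟨ *-monoʳ-≤ (suc m) (m≤n+o⇒m∸n≤o _ _ (C-drop m k t)) ⟩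
      suc m * (t * (m C k))               ≡⟨ x∙yz≈y∙xz (suc m) t (m C k) ⟩
      t * (suc m * (m C k))               ≡⟨ cong (t *_) (absorption m k) ⟩
      t * (suc k * (suc m C suc k))       ∎
    where open ≤-Reasoning

  meeting-lower : ∀ M k p → p ⊓ M * (M C suc k) ≤ M * meeting M (suc k) p
  meeting-lower M k p = begin
      p ⊓ M * (M C suc k)                         ≡⟨ cong (_* (M C suc k)) (sym (∸-∸≡⊓ M p)) ⟩
      (M ∸ (M ∸ p)) * (M C suc k)                 ≡⟨ *-distribʳ-∸ (M C suc k) M (M ∸ p) ⟩
      M * (M C suc k) ∸ (M ∸ p) * (M C suc k)     ≤⟨ ∸-monoʳ-≤ (M * (M C suc k)) (C-ratio k (m∸n≤m M p)) ⟩
      M * (M C suc k) ∸ M * ((M ∸ p) C suc k)     ≡⟨ sym (*-distribˡ-∸ M (M C suc k) _) ⟩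
      M * meeting M (suc k) p                     ∎
    where open ≤-Reasoning

  meeting-compare : ∀ m k D t p → k ≤ m → suc k * D * t < p ⊓ suc m →
                    D * meeting (suc m) (suc k) t < meeting (suc m) (suc k) p
  meeting-compare m k D t p k≤m small = *-cancelˡ-< (suc m) _ _ (begin-strict
      suc m * (D * meeting (suc m) (suc k) t)   ≡⟨ x∙yz≈y∙xz (suc m) D _ ⟩
      D * (suc m * meeting (suc m) (suc k) t)   ≤⟨ *-monoʳ-≤ D (meeting-upper m k t) ⟩
      D * (t * (suc k * c))                     ≡⟨ regroup (suc k) D t c ⟩
      suc k * D * t * c                         <⟨ *-monoˡ-< c {{>-nonZero (C-pos (s≤s k≤m))}} small ⟩
      p ⊓ suc m * c                             ≤⟨ meeting-lower (suc m) k p ⟩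
      suc m * meeting (suc m) (suc k) p         ∎)
    where
    open ≤-Reasoning
    c = suc m C suc k
    regroup : ∀ K D t c → D * (t * (K * c)) ≡ K * D * t * c
    regroup = solve-∀

open Binomial using (meeting; meeting-compare)

module Fractions where

  open import Data.Nat as ℕ using (ℕ; suc; s≤s; z≤n; _≤_; _<_)
  import Data.Nat.Properties as ℕP
  open import Data.Rational using (ℚ; 0ℚ; _*_) renaming (_≤_ to _≤ℚ_; _<_ to _<ℚ_)
  open import Data.Integer as ℤ using (+_; +<+)
  import Data.Integer.Properties as ℤP
  open import Data.Rational using (mkℚ; toℚᵘ; *<*)
  open import Data.Rational.Properties using (normalize-coprime; toℚᵘ-mono-≤; toℚᵘ-cancel-<; toℚᵘ-homo-*)
  open import Data.Rational.Unnormalised as U using (mkℚᵘ; *≤*) renaming (_≤_ to _≤ᵘ_; _<_ to _<ᵘ_; _≃_ to _≃ᵘ_)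
  import Data.Rational.Unnormalised.Properties as UP
  open import Data.Nat.Coprimality using (Coprime; 1-coprimeTo; sym)
  open import Relation.Binary.PropositionalEquality as Eq using (_≡_; cong; cong₂; subst; subst₂)

  1/suc : ℕ → ℚ
  1/suc c = mkℚ (+ 1) c (1-coprimeTo (suc c))

  1/suc-pos : ∀ c → 0ℚ <ℚ 1/suc c
  1/suc-pos c = *<* (+<+ (s≤s z≤n))

  1/suc-anti : ∀ {m n} → m < n → 1/suc n <ℚ 1/suc m
  1/suc-anti m<n =
    *<* (subst₂ ℤ._<_ (Eq.sym (ℤP.*-identityˡ _)) (Eq.sym (ℤP.*-identityˡ _)) (+<+ (s≤s m<n)))

  toℚᵘ-ℕ→ℚ : ∀ y → toℚᵘ (ℕ→ℚ y) ≡ mkℚᵘ (+ y) 0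
  toℚᵘ-ℕ→ℚ y = cong toℚᵘ (normalize-coprime {y} {0} (sym (1-coprimeTo y)))

  toℚᵘ-scaled : ∀ a d .(c : Coprime a (suc d)) y →
                toℚᵘ (mkℚ (+ a) d c * ℕ→ℚ y) ≃ᵘ mkℚᵘ (+ (a ℕ.* y)) d
  toℚᵘ-scaled a d c y = UP.≃-trans (toℚᵘ-homo-* (mkℚ (+ a) d c) (ℕ→ℚ y)) (UP.≃-reflexive product)
    where
    product : toℚᵘ (mkℚ (+ a) d c) U.* toℚᵘ (ℕ→ℚ y) ≡ mkℚᵘ (+ (a ℕ.* y)) d
    product rewrite toℚᵘ-ℕ→ℚ y = cong₂ mkℚᵘ (Eq.sym (ℤP.pos-* a y)) (ℕP.*-identityʳ d)

  ≤ᵘ⇒cross : ∀ {u v d₁ d₂} → mkℚᵘ (+ u) d₁ ≤ᵘ mkℚᵘ (+ v) d₂ → u ℕ.* suc d₂ ≤ v ℕ.* suc d₁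
  ≤ᵘ⇒cross {u} {v} {d₁} {d₂} (*≤* le) =
    ℤP.drop‿+≤+ (subst₂ ℤ._≤_ (Eq.sym (ℤP.pos-* u (suc d₂))) (Eq.sym (ℤP.pos-* v (suc d₁))) le)

  cross⇒<ᵘ : ∀ {u v d₁ d₂} → u ℕ.* suc d₂ < v ℕ.* suc d₁ → mkℚᵘ (+ u) d₁ <ᵘ mkℚᵘ (+ v) d₂
  cross⇒<ᵘ {u} {v} {d₁} {d₂} lt =
    U.*<* (subst₂ ℤ._<_ (ℤP.pos-* u (suc d₂)) (ℤP.pos-* v (suc d₁)) (+<+ lt))

  ≤-scaled⇒ : ∀ {x y a d} .{c : Coprime a (suc d)} →
              ℕ→ℚ x ≤ℚ mkℚ (+ a) d c * ℕ→ℚ y → x ℕ.* suc d ≤ a ℕ.* y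
  ≤-scaled⇒ {x} {y} {a} {d} {c} x≤qy = Eq.subst (x ℕ.* suc d ≤_) (ℕP.*-identityʳ (a ℕ.* y))
    (≤ᵘ⇒cross (UP.≤-respʳ-≃ (toℚᵘ-scaled a d c y) (subst (_≤ᵘ _) (toℚᵘ-ℕ→ℚ x) (toℚᵘ-mono-≤ x≤qy))))

  scaled-≤⇒ : ∀ {x y a d} .{c : Coprime a (suc d)} →
              mkℚ (+ a) d c * ℕ→ℚ y ≤ℚ ℕ→ℚ x → a ℕ.* y ≤ x ℕ.* suc d
  scaled-≤⇒ {x} {y} {a} {d} {c} qy≤x = Eq.subst (_≤ x ℕ.* suc d) (ℕP.*-identityʳ (a ℕ.* y))
    (≤ᵘ⇒cross (UP.≤-respˡ-≃ (toℚᵘ-scaled a d c y) (subst (_ ≤ᵘ_) (toℚᵘ-ℕ→ℚ x) (toℚᵘ-mono-≤ qy≤x))))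

  <-scaled⇐ : ∀ {x y a d} .{c : Coprime a (suc d)} →
              x ℕ.* suc d < a ℕ.* y → ℕ→ℚ x <ℚ mkℚ (+ a) d c * ℕ→ℚ y
  <-scaled⇐ {x} {y} {a} {d} {c} lt = toℚᵘ-cancel-<
    (UP.<-respʳ-≃ (UP.≃-sym (toℚᵘ-scaled a d c y))
      (subst (_<ᵘ _) (Eq.sym (toℚᵘ-ℕ→ℚ x))
        (cross⇒<ᵘ (Eq.subst (x ℕ.* suc d <_) (Eq.sym (ℕP.*-identityʳ (a ℕ.* y))) lt))))

open Fractions using (1/suc; 1/suc-pos; 1/suc-anti; ≤-scaled⇒; scaled-≤⇒; <-scaled⇐)

module NaturalBounds where

  open import Data.Nat
  open import Data.Nat.Properties
  open import Relation.Binary.PropositionalEquality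

  quarter : ∀ {x n m} → 0 < n → 4 * x ≤ n → n ≤ 2 * m → x < m
  quarter {x} {n} {m} 0<n 4x≤n n≤2m = *-cancelˡ-< 4 x m (begin-strict
      4 * x         ≤⟨ 4x≤n ⟩
      n             <⟨ m<m+n n 0<n ⟩
      n + n         ≤⟨ +-mono-≤ n≤2m n≤2m ⟩
      2 * m + 2 * m ≡⟨ sym (*-distribʳ-+ m 2 2) ⟩
      4 * m         ∎)
    where open ≤-Reasoning

  ≤2[1+∸] : ∀ s {n} → s + s ≤ n → n ≤ 2 * suc (n ∸ s)
  ≤2[1+∸] s {n} s+s≤n = begin
      n                          ≡⟨ sym (m+[n∸m]≡n (m+n≤o⇒m≤o s s+s≤n)) ⟩
      s + (n ∸ s)                ≤⟨ +-monoˡ-≤ (n ∸ s) (≤-trans (m+n≤o⇒m≤o∸n s s+s≤n) (n≤1+n _)) ⟩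
      suc (n ∸ s) + (n ∸ s)      ≤⟨ +-monoʳ-≤ (suc (n ∸ s)) (≤-trans (n≤1+n _) (≤-reflexive (sym (+-identityʳ _)))) ⟩
      2 * suc (n ∸ s)            ∎
    where open ≤-Reasoning

  N≡meeting : ∀ n t r s → N n t r s ≡ meeting (suc (n ∸ s)) (suc (r ∸ s)) t
  N≡meeting n t r s rewrite +-comm (n ∸ s) 1 | +-comm (r ∸ s) 1 = refl

  N-compare : ∀ r s D n t p → s < r → 2 * r ≤ n →
              t * suc (4 * (suc (r ∸ s) * D)) ≤ n → n ≤ 2 * p →
              D * N n t r s < N n p r s
  N-compare r s D n t p s<r 2r≤n t-small p-large rewrite N≡meeting n t r s | N≡meeting n p r s =
    meeting-compare (n ∸ s) (r ∸ s) D t p (∸-monoˡ-≤ s r≤n)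
      (quarter (≤-trans (s≤s z≤n) (≤-trans s<r r≤n)) 4KDt≤n n≤2min)
    where
    open ≤-Reasoning
    K = suc (r ∸ s)
    M = suc (n ∸ s)
    r≤n : r ≤ n
    r≤n = ≤-trans (m≤n*m r 2) 2r≤n
    4KDt≤n : 4 * (K * D * t) ≤ n
    4KDt≤n = begin
      4 * (K * D * t)           ≡⟨ sym (*-assoc 4 (K * D) t) ⟩
      4 * (K * D) * t           ≤⟨ m≤n+m (4 * (K * D) * t) t ⟩
      suc (4 * (K * D)) * t     ≡⟨ *-comm (suc (4 * (K * D))) t ⟩
      t * suc (4 * (K * D))     ≤⟨ t-small ⟩
      n                         ∎
    n≤2M : n ≤ 2 * M
    n≤2M = ≤2[1+∸] s (begin
      s + s                     ≤⟨ +-mono-≤ (<⇒≤ s<r) (<⇒≤ s<r) ⟩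
      r + r                     ≡⟨ cong (r +_) (sym (+-identityʳ r)) ⟩
      2 * r                     ≤⟨ 2r≤n ⟩
      n                         ∎)
    n≤2min : n ≤ 2 * (p ⊓ M)
    n≤2min = begin
      n                         ≤⟨ ⊓-glb p-large n≤2M ⟩
      (2 * p) ⊓ (2 * M)         ≡⟨ sym (*-distribˡ-⊓ 2 p M) ⟩
      2 * (p ⊓ M)               ∎

open NaturalBounds using (N-compare)

open import Data.Nat using (ℕ; _≤_; _<_)
open import Data.Rational using (ℚ; 0ℚ; 1ℚ; _*_) renaming (_≤_ to _≤ℚ_; _<_ to _<ℚ_)
open import Data.Product using (Σ; _×_; _,_)
open import Data.Nat as ℕ using (suc; _∸_; s≤s; z≤n)
import Data.Nat.Properties as ℕP
open import Data.Integer using (+_; -[1+_]; +<+)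
open import Data.Rational using (mkℚ; *<*)
open import Relation.Binary.PropositionalEquality using (subst)

lemma13 : (r s : ℕ) → 1 ≤ s → s < r → (α : ℚ) → 0ℚ <ℚ α → α <ℚ 1ℚ →
    Σ ℚ λ γ₀ → Σ ℚ λ γ₁ → Σ ℕ λ n₂ →
    (0ℚ <ℚ γ₀) × (γ₀ <ℚ γ₁) × (γ₁ <ℚ 1ℚ) × (0 < n₂) ×
    ((n t p : ℕ) → n₂ ≤ n →
    ℕ→ℚ t ≤ℚ γ₀ * ℕ→ℚ n →
    γ₁ * ℕ→ℚ n ≤ℚ ℕ→ℚ p → p ≤ n →
    ℕ→ℚ (N n t r s) <ℚ α * ℕ→ℚ (N n p r s))
lemma13 r s _ _ (mkℚ (+ 0) d c) (*<* (+<+ ())) _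
lemma13 r s _ _ (mkℚ -[1+ a ] d c) (*<* ()) _
lemma13 r s _ s<r (mkℚ (+ suc a) d c) _ _ =
  1/suc c' , 1/suc 1 , 2 ℕ.* r ,
  1/suc-pos c' , 1/suc-anti 1<c' , 1/suc-anti (s≤s z≤n) ,
  ℕP.≤-trans (s≤s z≤n) (ℕP.≤-trans s<r (ℕP.m≤n*m r 2)) , bound
  where
  D = suc d
  c' = 4 ℕ.* (suc (r ∸ s) ℕ.* D)
  1<c' : 1 < c'
  1<c' = ℕP.≤-trans (s≤s (s≤s z≤n)) (ℕP.m≤m*n 4 (suc (r ∸ s) ℕ.* D))
  bound : (n t p : ℕ) → 2 ℕ.* r ≤ n → ℕ→ℚ t ≤ℚ 1/suc c' * ℕ→ℚ n →
          1/suc 1 * ℕ→ℚ n ≤ℚ ℕ→ℚ p → p ≤ n →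
          ℕ→ℚ (N n t r s) <ℚ mkℚ (+ suc a) d c * ℕ→ℚ (N n p r s)
  bound n t p 2r≤n t≤γ₀n γ₁n≤p _ = <-scaled⇐ {N n t r s} {N n p r s} {suc a} {d}
    (ℕP.<-≤-trans (subst (ℕ._< N n p r s) (ℕP.*-comm D (N n t r s)) D·Nt<Np) (ℕP.m≤n*m (N n p r s) (suc a)))
    where
    D·Nt<Np : D ℕ.* N n t r s < N n p r s
    D·Nt<Np = N-compare r s D n t p s<r 2r≤n
      (subst (t ℕ.* suc c' ≤_) (ℕP.*-identityˡ n) (≤-scaled⇒ {t} {n} {1} {c'} t≤γ₀n))
      (subst (_≤ 2 ℕ.* p) (ℕP.*-identityˡ n) (subst (1 ℕ.* n ≤_) (ℕP.*-comm p 2) (scaled-≤⇒ {p} {n} {1} {1} γ₁n≤p)))
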